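{- Let $n\ge 3$, let $C_n$ be the cycle graph on $n$ vertices, and let $k$ be an integer with $1\le k\le n-2$. Then \[ \phi_k(C_n)=\begin{cases}2 & \text{if } n-k \text{ is even},\\ 3 & \text{if } n-k \text{ is odd.}\end{cases} \]
   Context: For a graph $G$ and a vertex coloring $c:V(G)\to\{1,\dots,\ell\}$ (not required to be proper or surjective), an edge $uv$ is called bad if $c(u)=c(v)$. For an integer $k\ge 0$, the $k$-defect number $\phi_k(G)$ is the smallest positive integer $\ell$ such that there is a coloring $c:V(G)\to\{1,\dots,\ell\}$ with exactly $k$ bad edges; if no coloring (with any number of colors) has exactly $k$ bad edges, then $\phi_k(G)=0$ by convention. In particular $\phi_0(G)=\chi(G)$. -}

module Defs where

open import Data.Nat using (ℕ; zero; suc; _≤_; _<_)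
open import Data.Nat.DivMod using (_mod_)
open import Data.Fin using (Fin; toℕ)
open import Data.Fin.Properties using () renaming (_≟_ to _≟ᶠ_)
open import Data.List using (List; []; map; filter; length; allFin)
open import Data.Product using (_×_; _,_; proj₁; proj₂; ∃)
open import Relation.Nullary using (¬_)

record Graph : Set where
  field
    order : ℕ
    edges : List (Fin order × Fin order)
open Graph public

cycleEdges : (n : ℕ) → List (Fin n × Fin n)
cycleEdges zero = []
cycleEdges (suc m) = map (λ i → i , (suc (toℕ i)) mod (suc m)) (allFin (suc m))

Cycle : ℕ → Graph
Cycle n = record { order = n ; edges = cycleEdges n }

-- Colourings with colours {1..ℓ}, represented as Fin ℓ (not nec. proper or surjective).
Coloring : Graph → ℕ → Set
Coloring G ℓ = Fin (order G) → Fin ℓ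

badEdges : (G : Graph) {ℓ : ℕ} → Coloring G ℓ → ℕ
badEdges G c = length (filter (λ e → c (proj₁ e) ≟ᶠ c (proj₂ e)) (edges G))

HasDefect : (G : Graph) → ℕ → ℕ → Set
HasDefect G k ℓ = ∃ λ (c : Coloring G ℓ) → badEdges G c ≡ k
  where open import Relation.Binary.PropositionalEquality using (_≡_)

IsDefectNumber : (G : Graph) → ℕ → ℕ → Set
IsDefectNumber G k ℓ =
  (1 ≤ ℓ) × HasDefect G k ℓ × (∀ ℓ′ → 1 ≤ ℓ′ → ℓ′ < ℓ → ¬ HasDefect G k ℓ′)

-- A colouring of C_n with k bad edges has n − k colour changes around the
-- cycle. With one colour every edge is bad, so k = n. With two colours the
-- changes along a closed walk are even in number, so n − k is even. Conversely,
-- colouring vertices 0, …, k alike and alternating afterwards gives exactly k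
-- bad edges with two colours when n − k is even; when n − k is odd, recolouring
-- the last vertex with a third colour repairs the closing edge.
module Submission where

open import Defs
open import Data.Nat using (ℕ; _≤_; _+_; _∸_; _%_)
open import Data.Product using (_×_)
open import Relation.Binary.PropositionalEquality using (_≡_)

open import Data.Bool using (Bool; true; false; not; if_then_else_)
open import Data.Fin using (Fin; zero; suc; toℕ)
open import Data.Fin.Properties using (_≟_; toℕ-injective; toℕ-fromℕ<; toℕ<n)
open import Data.List using (length; filter; map; tabulate)
open import Data.List.Properties using (map-tabulate; tabulate-cong)
open import Data.Nat using (zero; suc; _<_; _<?_; z≤n; s≤s; s≤s⁻¹; parity)
open import Data.Nat.DivMod using (_mod_; m<n⇒m%n≡m; n%n≡0; [m+n]%n≡m%n)
open import Data.Nat.Properties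
  using (≤-refl; ≤-trans; <-trans; ≤-<-trans; <-irrefl; <⇒≤; <⇒≢; <⇒≱; n<1+n; m≤n⇒m≤1+n;
         m≤n⇒m<n∨m≡n; +-comm; +-suc; 0∸n≡0; m≤n⇒m∸n≡0; +-∸-assoc; m+n∸m≡n)
open import Data.Parity.Base using (Parity; 0ℙ; 1ℙ; _⁻¹) renaming (_+_ to _+ℙ_)
open import Data.Parity.Properties using (p+p≡0ℙ; +-homo-+; suc-homo-⁻¹) renaming (+-assoc to +ℙ-assoc)
open import Data.Product using (_,_; proj₁; proj₂)
open import Data.Sum using (inj₁; inj₂)
open import Function using (_∘_; id)
open import Relation.Binary.PropositionalEquality
  using (_≢_; refl; sym; trans; cong; cong₂; subst; module ≡-Reasoning)
open import Relation.Nullary using (¬_; Dec; does; contradiction)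
open import Relation.Nullary.Decidable using (dec-true; dec-false)
open import Relation.Unary using (Pred; Decidable)

open ≡-Reasoning

indicator : Bool → ℕ
indicator true  = 1
indicator false = 0

count : ℕ → (ℕ → Bool) → ℕ
count zero    F = 0
count (suc N) F = indicator (F 0) + count N (F ∘ suc)

count-complement : ∀ N (F : ℕ → Bool) → count N F + count N (not ∘ F) ≡ N
count-complement zero    F = refl
count-complement (suc N) F with F 0 | count-complement N (F ∘ suc)
... | true  | ih = cong suc ih
... | false | ih = trans (+-suc _ _) (cong suc ih)

count-prefix : ∀ {a N} (F : ℕ → Bool) → a ≤ N →
  (∀ j → j < a → F j ≡ true) → (∀ j → a ≤ j → j < N → F j ≡ false) → count N F ≡ a
count-prefix {zero}  {zero}  F _ _ _ = refl
count-prefix {zero}  {suc N} F _ _ false-from rewrite false-from 0 z≤n (s≤s z≤n) =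
  count-prefix (F ∘ suc) z≤n (λ _ ()) (λ j _ j<N → false-from (suc j) z≤n (s≤s j<N))
count-prefix {suc a} {suc N} F (s≤s a≤N) true-below false-from rewrite true-below 0 (s≤s z≤n) =
  cong suc (count-prefix (F ∘ suc) a≤N (λ j j<a → true-below (suc j) (s≤s j<a))
                                        (λ j a≤j j<N → false-from (suc j) (s≤s a≤j) (s≤s j<N)))

length-filter-tabulate : ∀ {a p} {A : Set a} {P : Pred A p} (P? : Decidable P) n (f : ℕ → A) →
  length (filter P? (tabulate {n = n} (f ∘ toℕ))) ≡ count n (λ j → does (P? (f j)))
length-filter-tabulate P? zero    f = refl
length-filter-tabulate P? (suc n) f with does (P? (f 0))
... | true  = cong suc (length-filter-tabulate P? n (f ∘ suc))
... | false = length-filter-tabulate P? n (f ∘ suc)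

monochromatic : ∀ {ℓ} → (ℕ → Fin ℓ) → ℕ → ℕ
monochromatic w N = count N (λ j → does (w j ≟ w (suc j)))

colourChanges : ∀ {ℓ} → (ℕ → Fin ℓ) → ℕ → ℕ
colourChanges w N = count N (λ j → not (does (w j ≟ w (suc j))))

closedWalk : ∀ {ℓ m} → (Fin (suc m) → Fin ℓ) → ℕ → Fin ℓ
closedWalk {m = m} c j = c (j mod suc m)

toℕ-mod : ∀ {m j} → j < suc m → toℕ (j mod suc m) ≡ j
toℕ-mod j<n = trans (toℕ-fromℕ< _) (m<n⇒m%n≡m j<n)

closedWalk-< : ∀ {ℓ m j} (h : ℕ → Fin ℓ) → j < suc m → closedWalk {m = m} (h ∘ toℕ) j ≡ h j
closedWalk-< h j<n = cong h (toℕ-mod j<n)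

closedWalk-wraps : ∀ {ℓ m} (c : Fin (suc m) → Fin ℓ) → closedWalk c (suc m) ≡ c zero
closedWalk-wraps {m = m} c = cong c (toℕ-injective (trans (toℕ-fromℕ< _) (n%n≡0 (suc m))))

badEdges-Cycle : ∀ {ℓ m} (c : Coloring (Cycle (suc m)) ℓ) →
  badEdges (Cycle (suc m)) c ≡ monochromatic (closedWalk c) (suc m)
badEdges-Cycle {m = m} c = begin
  length (filter P? (map edge (tabulate id)))
    ≡⟨ cong (length ∘ filter P?) (map-tabulate id edge) ⟩
  length (filter P? (tabulate edge))
    ≡⟨ cong (length ∘ filter P?) (tabulate-cong edge≡) ⟩
  length (filter P? (tabulate {n = suc m} (edgeAt ∘ toℕ)))
    ≡⟨ length-filter-tabulate P? (suc m) edgeAt ⟩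
  monochromatic (closedWalk c) (suc m)
    ∎
  where
  edge : Fin (suc m) → Fin (suc m) × Fin (suc m)
  edge i = i , suc (toℕ i) mod suc m
  edgeAt : ℕ → Fin (suc m) × Fin (suc m)
  edgeAt j = j mod suc m , suc j mod suc m
  P? : (e : Fin (suc m) × Fin (suc m)) → Dec (c (proj₁ e) ≡ c (proj₂ e))
  P? e = c (proj₁ e) ≟ c (proj₂ e)
  edge≡ : ∀ i → edge i ≡ edgeAt (toℕ i)
  edge≡ i = cong (_, suc (toℕ i) mod suc m) (sym (toℕ-injective (toℕ-mod (toℕ<n i))))

one-colour-badEdges : ∀ {m} (c : Coloring (Cycle (suc m)) 1) → badEdges (Cycle (suc m)) c ≡ suc m
one-colour-badEdges {m} c = trans (badEdges-Cycle c)
  (count-prefix _ ≤-refl (λ j _ → dec-true (w j ≟ w (suc j)) (Fin1-≡ (w j) (w (suc j))))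
                         (λ j n≤j j<n → contradiction n≤j (<⇒≱ j<n)))
  where
  w : ℕ → Fin 1
  w = closedWalk c
  Fin1-≡ : (a b : Fin 1) → a ≡ b
  Fin1-≡ zero zero = refl

colourParity : Fin 2 → Parity
colourParity zero       = 0ℙ
colourParity (suc zero) = 1ℙ

parity-colourChange : (a b : Fin 2) →
  parity (indicator (not (does (a ≟ b)))) ≡ colourParity a +ℙ colourParity b
parity-colourChange zero       zero       = refl
parity-colourChange zero       (suc zero) = refl
parity-colourChange (suc zero) zero       = refl
parity-colourChange (suc zero) (suc zero) = refl

+ℙ-cancel-middle : ∀ p q r → (p +ℙ q) +ℙ (q +ℙ r) ≡ p +ℙ r
+ℙ-cancel-middle p q r = begin
  (p +ℙ q) +ℙ (q +ℙ r)  ≡⟨ +ℙ-assoc p q (q +ℙ r) ⟩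
  p +ℙ (q +ℙ (q +ℙ r))  ≡⟨ cong (p +ℙ_) (sym (+ℙ-assoc q q r)) ⟩
  p +ℙ ((q +ℙ q) +ℙ r)  ≡⟨ cong (λ x → p +ℙ (x +ℙ r)) (p+p≡0ℙ q) ⟩
  p +ℙ r                ∎

parity-colourChanges : ∀ (w : ℕ → Fin 2) N →
  parity (colourChanges w N) ≡ colourParity (w 0) +ℙ colourParity (w N)
parity-colourChanges w zero    = sym (p+p≡0ℙ (colourParity (w 0)))
parity-colourChanges w (suc N) = begin
  parity (indicator (not (does (w 0 ≟ w 1))) + colourChanges (w ∘ suc) N)
    ≡⟨ +-homo-+ (indicator (not (does (w 0 ≟ w 1)))) _ ⟩
  parity (indicator (not (does (w 0 ≟ w 1)))) +ℙ parity (colourChanges (w ∘ suc) N)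
    ≡⟨ cong₂ _+ℙ_ (parity-colourChange (w 0) (w 1)) (parity-colourChanges (w ∘ suc) N) ⟩
  (colourParity (w 0) +ℙ colourParity (w 1)) +ℙ (colourParity (w 1) +ℙ colourParity (w (suc N)))
    ≡⟨ +ℙ-cancel-middle (colourParity (w 0)) (colourParity (w 1)) (colourParity (w (suc N))) ⟩
  colourParity (w 0) +ℙ colourParity (w (suc N))
    ∎

two-colour-badEdges-parity : ∀ {m} (c : Coloring (Cycle (suc m)) 2) →
  parity (suc m ∸ badEdges (Cycle (suc m)) c) ≡ 0ℙ
two-colour-badEdges-parity {m} c = begin
  parity (suc m ∸ badEdges (Cycle (suc m)) c)
    ≡⟨ cong (λ b → parity (suc m ∸ b)) (badEdges-Cycle c) ⟩
  parity (suc m ∸ monochromatic w (suc m))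
    ≡⟨ cong (λ n → parity (n ∸ monochromatic w (suc m))) (sym (count-complement (suc m) sameColour)) ⟩
  parity (monochromatic w (suc m) + colourChanges w (suc m) ∸ monochromatic w (suc m))
    ≡⟨ cong parity (m+n∸m≡n (monochromatic w (suc m)) _) ⟩
  parity (colourChanges w (suc m))
    ≡⟨ parity-colourChanges w (suc m) ⟩
  colourParity (c zero) +ℙ colourParity (w (suc m))
    ≡⟨ cong (λ a → colourParity (c zero) +ℙ colourParity a) (closedWalk-wraps c) ⟩
  colourParity (c zero) +ℙ colourParity (c zero)
    ≡⟨ p+p≡0ℙ (colourParity (c zero)) ⟩
  0ℙ
    ∎
  where
  w : ℕ → Fin 2
  w = closedWalk c
  sameColour : ℕ → Bool
  sameColour j = does (w j ≟ w (suc j))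

¬hasDefect-one-colour : ∀ {m k} → k < suc m → ¬ HasDefect (Cycle (suc m)) k 1
¬hasDefect-one-colour k<n (c , bad≡k) = <⇒≢ k<n (trans (sym bad≡k) (one-colour-badEdges c))

¬hasDefect-two-colours : ∀ {m k} → parity (suc m ∸ k) ≡ 1ℙ → ¬ HasDefect (Cycle (suc m)) k 2
¬hasDefect-two-colours odd (c , refl) =
  contradiction (trans (sym odd) (two-colour-badEdges-parity c)) λ ()

parity-%2 : ∀ n → parity n ≡ parity (n % 2)
parity-%2 0             = refl
parity-%2 1             = refl
parity-%2 (suc (suc n)) =
  trans (parity-%2 n) (cong parity (sym (trans (cong (_% 2) (+-comm 2 n)) ([m+n]%n≡m%n n 2))))

hasDefect-Cycle : ∀ {ℓ m k} (h : ℕ → Fin ℓ) → k ≤ m →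
  (∀ j → j < k → h j ≡ h (suc j)) →
  (∀ j → k ≤ j → j < m → h j ≢ h (suc j)) →
  h m ≢ h 0 →
  HasDefect (Cycle (suc m)) k ℓ
hasDefect-Cycle {ℓ} {m} {k} h k≤m same differ closing = h ∘ toℕ , (begin
  badEdges (Cycle (suc m)) (h ∘ toℕ)  ≡⟨ badEdges-Cycle (h ∘ toℕ) ⟩
  monochromatic w (suc m)            ≡⟨ count-prefix _ (m≤n⇒m≤1+n k≤m) bad good ⟩
  k                                  ∎)
  where
  w : ℕ → Fin ℓ
  w = closedWalk (h ∘ toℕ)
  bad : ∀ j → j < k → does (w j ≟ w (suc j)) ≡ true
  bad j j<k = dec-true (w j ≟ w (suc j)) (begin
    w j        ≡⟨ closedWalk-< h (≤-trans j<k (m≤n⇒m≤1+n k≤m)) ⟩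
    h j        ≡⟨ same j j<k ⟩
    h (suc j)  ≡⟨ closedWalk-< h (s≤s (≤-trans j<k k≤m)) ⟨
    w (suc j)  ∎)
  good : ∀ j → k ≤ j → j < suc m → does (w j ≟ w (suc j)) ≡ false
  good j k≤j j<n with m≤n⇒m<n∨m≡n (s≤s⁻¹ j<n)
  ... | inj₁ j<m = dec-false (w j ≟ w (suc j)) λ eq →
    differ j k≤j j<m (trans (sym (closedWalk-< h j<n)) (trans eq (closedWalk-< h (s≤s j<m))))
  ... | inj₂ refl = dec-false (w j ≟ w (suc j)) λ eq →
    closing (trans (sym (closedWalk-< h j<n)) (trans eq (closedWalk-wraps (h ∘ toℕ))))

alternating : ∀ {ℓ} → ℕ → Fin (suc (suc ℓ))
alternating zero          = zero
alternating (suc zero)    = suc zero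
alternating (suc (suc x)) = alternating x

alternating-suc-≢ : ∀ {ℓ} x → alternating {ℓ} x ≢ alternating (suc x)
alternating-suc-≢ zero          = λ ()
alternating-suc-≢ (suc zero)    = λ ()
alternating-suc-≢ (suc (suc x)) = alternating-suc-≢ x

alternating-odd : ∀ {ℓ} x → parity x ≡ 1ℙ → alternating {ℓ} x ≡ suc zero
alternating-odd (suc zero)    _   = refl
alternating-odd (suc (suc x)) odd = alternating-odd x odd

alternating-≢-2 : ∀ {ℓ} x → alternating {suc ℓ} x ≢ suc (suc zero)
alternating-≢-2 zero          = λ ()
alternating-≢-2 (suc zero)    = λ ()
alternating-≢-2 (suc (suc x)) = alternating-≢-2 x

alternatingFrom : ∀ {ℓ} → ℕ → ℕ → Fin (suc (suc ℓ))
alternatingFrom k j = alternating (j ∸ k)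

alternatingFrom-zero : ∀ {ℓ} k → alternatingFrom {ℓ} k 0 ≡ zero
alternatingFrom-zero k = cong alternating (0∸n≡0 k)

alternatingFrom-const : ∀ {ℓ k j} → j < k → alternatingFrom {ℓ} k j ≡ alternatingFrom k (suc j)
alternatingFrom-const j<k = cong alternating (trans (m≤n⇒m∸n≡0 (<⇒≤ j<k)) (sym (m≤n⇒m∸n≡0 j<k)))

alternatingFrom-alternates : ∀ {ℓ k j} → k ≤ j → alternatingFrom {ℓ} k j ≢ alternatingFrom k (suc j)
alternatingFrom-alternates {k = k} {j} k≤j rewrite +-∸-assoc 1 k≤j = alternating-suc-≢ (j ∸ k)

hasDefect-two-colours : ∀ {m k} → k ≤ m → parity (suc m ∸ k) ≡ 0ℙ → HasDefect (Cycle (suc m)) k 2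
hasDefect-two-colours {m} {k} k≤m even =
  hasDefect-Cycle (alternatingFrom k) k≤m (λ _ → alternatingFrom-const)
                  (λ _ k≤j _ → alternatingFrom-alternates k≤j) closing
  where
  m∸k-odd : parity (m ∸ k) ≡ 1ℙ
  m∸k-odd = begin
    parity (m ∸ k)            ≡⟨ suc-homo-⁻¹ (m ∸ k) ⟨
    parity (suc (m ∸ k)) ⁻¹   ≡⟨ cong (λ n → parity n ⁻¹) (+-∸-assoc 1 k≤m) ⟨
    parity (suc m ∸ k) ⁻¹     ≡⟨ cong _⁻¹ even ⟩
    1ℙ                        ∎
  closing : alternatingFrom k m ≢ alternatingFrom k 0
  closing eq = contradiction (trans (sym (alternating-odd (m ∸ k) m∸k-odd))
                                    (trans eq (alternatingFrom-zero k))) λ ()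

hasDefect-three-colours : ∀ {m k} → k < m → HasDefect (Cycle (suc m)) k 3
hasDefect-three-colours {m} {k} k<m = hasDefect-Cycle h (<⇒≤ k<m) same differ closing
  where
  h : ℕ → Fin 3
  h j = if does (j <? m) then alternatingFrom k j else suc (suc zero)
  h-< : ∀ {j} → j < m → h j ≡ alternatingFrom k j
  h-< {j} j<m rewrite dec-true (j <? m) j<m = refl
  h-m : h m ≡ suc (suc zero)
  h-m rewrite dec-false (m <? m) (<-irrefl refl) = refl
  same : ∀ j → j < k → h j ≡ h (suc j)
  same j j<k = begin
    h j                        ≡⟨ h-< (<-trans j<k k<m) ⟩
    alternatingFrom k j        ≡⟨ alternatingFrom-const j<k ⟩
    alternatingFrom k (suc j)  ≡⟨ h-< (≤-<-trans j<k k<m) ⟨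
    h (suc j)                  ∎
  differ : ∀ j → k ≤ j → j < m → h j ≢ h (suc j)
  differ j k≤j j<m eq with m≤n⇒m<n∨m≡n j<m
  ... | inj₁ sj<m = alternatingFrom-alternates k≤j (trans (sym (h-< j<m)) (trans eq (h-< sj<m)))
  ... | inj₂ sj≡m =
    alternating-≢-2 (j ∸ k) (trans (sym (h-< j<m)) (trans eq (trans (cong h sj≡m) h-m)))
  closing : h m ≢ h 0
  closing eq = contradiction
    (trans (sym h-m) (trans eq (trans (h-< (≤-<-trans z≤n k<m)) (alternatingFrom-zero k)))) λ ()

mainTheorem1 : (n k : ℕ) → 3 ≤ n → 1 ≤ k → k + 2 ≤ n →
    ((n ∸ k) % 2 ≡ 0 → IsDefectNumber (Cycle n) k 2) ×
    ((n ∸ k) % 2 ≡ 1 → IsDefectNumber (Cycle n) k 3)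
mainTheorem1 (suc m) k _ _ k+2≤n = even , odd
  where
  k<m : k < m
  k<m = s≤s⁻¹ (subst (_≤ suc m) (+-comm k 2) k+2≤n)
  parity-from-%2 : ∀ {r} → (suc m ∸ k) % 2 ≡ r → parity (suc m ∸ k) ≡ parity r
  parity-from-%2 e = trans (parity-%2 (suc m ∸ k)) (cong parity e)
  no-one-colouring : ¬ HasDefect (Cycle (suc m)) k 1
  no-one-colouring = ¬hasDefect-one-colour (<-trans k<m (n<1+n m))
  even : (suc m ∸ k) % 2 ≡ 0 → IsDefectNumber (Cycle (suc m)) k 2
  even e = s≤s z≤n , hasDefect-two-colours (<⇒≤ k<m) (parity-from-%2 e) , λ where
    1 _ _ → no-one-colouring
    (suc (suc _)) _ (s≤s (s≤s ()))
  odd : (suc m ∸ k) % 2 ≡ 1 → IsDefectNumber (Cycle (suc m)) k 3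
  odd e = s≤s z≤n , hasDefect-three-colours k<m , λ where
    1 _ _ → no-one-colouring
    2 _ _ → ¬hasDefect-two-colours (parity-from-%2 e)
    (suc (suc (suc _))) _ (s≤s (s≤s (s≤s ())))
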